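{- Let $\mathbf{h}=0112122122212222122222\cdots$ be the fixed point starting with $0$ of the morphism $0\mapsto01$, $1\mapsto12$, $2\mapsto2$. Then the abelian complexity $b^{(1)}_{\mathbf{h}}$ is unbounded and $b^{(1)}_{\mathbf{h}}\prec b^{(2)}_{\mathbf{h}}\prec b^{(3)}_{\mathbf{h}}=p_{\mathbf{h}}$.
   Context: For words $u,w$, $\binom{u}{w}$ is the number of occurrences of $w$ as a scattered subword of $u$; $u\sim_j v$ if $\binom{u}{x}=\binom{v}{x}$ for all words $x$ of length at most $j$. $b^{(j)}_{\mathbf{x}}(n)$ is the number of $\sim_j$-classes among length-$n$ factors of $\mathbf{x}$ ($j=1$ gives the abelian complexity), and $p_{\mathbf{x}}(n)$ is the number of length-$n$ factors. For $f,g\colon\mathbb{N}\to\mathbb{N}$, $f\prec g$ means $f(n)<g(n)$ for infinitely many $n$. -}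

module Defs where

open import Data.Nat using (ℕ; zero; suc; _+_; _≤_; _<_)
open import Data.Fin using (Fin; zero; suc)
open import Data.Fin.Properties using (_≟_)
open import Data.List using (List; []; _∷_; _++_; concatMap; length)
open import Data.Product using (Σ; ∃; _×_; _,_)
open import Relation.Binary.PropositionalEquality using (_≡_; _≢_)
open import Relation.Nullary using (¬_; yes; no)

Letter : Set
Letter = Fin 3

Word : Set
Word = List Letter

φ : Letter → Word
φ zero = zero ∷ suc zero ∷ []
φ (suc zero) = suc zero ∷ suc (suc zero) ∷ []
φ (suc (suc zero)) = suc (suc zero) ∷ []

φ* : Word → Word
φ* = concatMap φ

iter : ℕ → Word
iter zero = zero ∷ []
iter (suc n) = φ* (iter n)

lookupD : Word → ℕ → Letter
lookupD [] _ = zero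
lookupD (a ∷ u) zero = a
lookupD (a ∷ u) (suc i) = lookupD u i

-- The fixed point h = lim φ^n(0) starting with 0.  Since |φ^n(0)| ≥ n+1 and
-- each φ^n(0) is a prefix of φ^{n+1}(0), h(i) is the i-th letter of φ^{i+1}(0)
-- (the default in lookupD is never used).
h : ℕ → Letter
h i = lookupD (iter (suc i)) i

factor : ℕ → ℕ → Word
factor i zero = []
factor i (suc n) = h i ∷ factor (suc i) n

binom : Word → Word → ℕ
binom u [] = 1
binom [] (b ∷ w) = 0
binom (a ∷ u) (b ∷ w) with a ≟ b
... | yes _ = binom u w + binom u (b ∷ w)
... | no _ = binom u (b ∷ w)

_∼[_]_ : Word → ℕ → Word → Set
u ∼[ j ] v = (x : Word) → length x ≤ j → binom u x ≡ binom v x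

-- "the length-n factors of h fall into exactly k classes of the relation R":
-- there are k factors (at positions pos a) pairwise R-inequivalent, and every
-- length-n factor is R-related to one of them.
ClassCount : (Word → Word → Set) → ℕ → ℕ → Set
ClassCount R n k =
  Σ (Fin k → ℕ) λ pos →
    ((a b : Fin k) → a ≢ b → ¬ R (factor (pos a) n) (factor (pos b) n)) ×
    ((i : ℕ) → ∃ λ a → R (factor i n) (factor (pos a) n))

BinomComplexity : ℕ → ℕ → ℕ → Set
BinomComplexity j = ClassCount (λ u v → u ∼[ j ] v)

FactorComplexity : ℕ → ℕ → Set
FactorComplexity = ClassCount _≡_

_≺_ : (ℕ → ℕ → Set) → (ℕ → ℕ → Set) → Set
F ≺ G = (N : ℕ) → ∃ λ n → N ≤ n × ∃ λ k → ∃ λ l → F n k × G n l × k < l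

{-# OPTIONS --safe #-}
-- h = 0 B₀ B₁ B₂ ⋯ with blocks B_k = 1 2^k, the block B_k starting at position 1 + k(k+1)/2.
-- Blocks beyond B_n are longer than n, so a factor of length n there contains at most one 1, and
-- all such factors already occur before B_(n+1): every class count is found by a finite search.
-- A factor not starting at 0 is either 2^n or 2^a B_j B_(j+1) ⋯ B_(j+m-1) 1 2^c. Its numbers of
-- occurrences of 1, 121, 12 and its length determine m, then j (the count of 121 grows strictly
-- with j), then c and a; hence 3-binomial equivalence is equality on factors.
-- Sliding a window of length |φ^M(0)| from φ^M(0), which contains M letters 1, to a run of 2s
-- changes the number of 1s by at most one per step, which yields M + 1 abelian classes.
-- Finally 1 2^(N+1) and 2 1 2^N are abelian equivalent but differ on 12, while 1 2^(b+2) 1 and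
-- 2 1 2^b 1 2 are 2-binomially equivalent but differ on 121; both pairs occur in h at all large lengths.
module Submission where

open import Defs
open import Data.Empty using (⊥-elim)
open import Data.Fin using (Fin; zero; suc; toℕ)
import Data.Fin.Properties as Fin
open import Data.List using ([]; _∷_; _++_; length; replicate; concat; map)
open import Data.List.Properties using (∷-injectiveʳ; ++-assoc; ++-identityʳ; length-++; length-replicate; map-++; concat-++)
open import Data.Nat using (ℕ; zero; suc; _+_; _*_; _≤_; _<_; z≤n; s≤s; z<s)
open import Data.Nat.Properties
open import Data.Nat.Combinatorics using (_C_; nC1≡n; nCk+nC[k+1]≡[n+1]C[k+1])
open import Data.Nat.Tactic.RingSolver using (solve-∀)
open import Data.Product using (Σ; ∃; ∃₂; _×_; _,_; proj₁; proj₂)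
open import Data.Sum using (inj₁; inj₂)
open import Relation.Binary.Definitions using (tri<; tri≈; tri>)
open import Relation.Binary.Structures using (IsEquivalence; IsDecEquivalence)
open import Relation.Binary.PropositionalEquality
open import Relation.Nullary using (¬_; Dec; yes; no)

-- The block structure of h

one two : Letter
one = suc zero
two = suc (suc zero)

twos : ℕ → Word
twos k = replicate k two

twos-snoc : (k : ℕ) → twos k ++ two ∷ [] ≡ twos (suc k)
twos-snoc zero = refl
twos-snoc (suc k) = cong (two ∷_) (twos-snoc k)

block : ℕ → Word
block k = one ∷ twos k

prefix : ℕ → Word
prefix zero = zero ∷ []
prefix (suc n) = prefix n ++ block n

φ*-++ : (u v : Word) → φ* (u ++ v) ≡ φ* u ++ φ* v
φ*-++ u v = trans (cong concat (map-++ φ u v)) (sym (concat-++ (map φ u) _))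

φ*-twos : (k : ℕ) → φ* (twos k) ≡ twos k
φ*-twos zero = refl
φ*-twos (suc k) = cong (two ∷_) (φ*-twos k)

φ*-prefix : (n : ℕ) → φ* (prefix n) ≡ prefix (suc n)
φ*-prefix zero = refl
φ*-prefix (suc n) = begin
  φ* (prefix n ++ block n)          ≡⟨ φ*-++ (prefix n) (block n) ⟩
  φ* (prefix n) ++ one ∷ φ* (two ∷ twos n) ≡⟨ cong₂ _++_ (φ*-prefix n) (cong (one ∷_) (φ*-twos (suc n))) ⟩
  prefix (suc n) ++ block (suc n)   ∎
  where open ≡-Reasoning

iter≡prefix : (n : ℕ) → iter n ≡ prefix n
iter≡prefix zero = refl
iter≡prefix (suc n) = trans (cong φ* (iter≡prefix n)) (φ*-prefix n)

triangle : ℕ → ℕ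
triangle zero = 0
triangle (suc k) = triangle k + suc k

k≤triangle : (k : ℕ) → k ≤ triangle k
k≤triangle zero = z≤n
k≤triangle (suc k) = m≤n+m (suc k) (triangle k)

triangle-mono : ∀ {a b} → a ≤ b → triangle a ≤ triangle b
triangle-mono {zero} _ = z≤n
triangle-mono {suc a} {suc b} (s≤s a≤b) = +-mono-≤ (triangle-mono a≤b) (s≤s a≤b)

blockStart : ℕ → ℕ
blockStart k = suc (triangle k)

length-prefix : (n : ℕ) → length (prefix n) ≡ blockStart n
length-prefix zero = refl
length-prefix (suc n) =
  trans (length-++ (prefix n)) (cong₂ _+_ (length-prefix n) (cong suc (length-replicate n)))

prefix-mono : ∀ {m n} → m ≤ n → ∃ λ zs → prefix n ≡ prefix m ++ zs
prefix-mono {m} {zero} z≤n = [] , sym (++-identityʳ (prefix m))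
prefix-mono {m} {suc n} m≤1+n with m≤n⇒m<n∨m≡n m≤1+n
... | inj₂ refl = [] , sym (++-identityʳ (prefix m))
... | inj₁ m≤n with prefix-mono (≤-pred m≤n)
...   | zs , eq = zs ++ block n , trans (cong (_++ block n) eq) (++-assoc (prefix m) zs (block n))

lookupD-++ˡ : (u v : Word) {i : ℕ} → i < length u → lookupD (u ++ v) i ≡ lookupD u i
lookupD-++ˡ (a ∷ u) v {zero} _ = refl
lookupD-++ˡ (a ∷ u) v {suc i} (s≤s i<) = lookupD-++ˡ u v i<

lookupD-++ʳ : (u v : Word) (i : ℕ) → lookupD (u ++ v) (length u + i) ≡ lookupD v i
lookupD-++ʳ [] v i = refl
lookupD-++ʳ (a ∷ u) v i = lookupD-++ʳ u v i

spike : ℕ → ℕ → Letter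
spike zero zero = one
spike zero (suc t) = two
spike (suc d) zero = two
spike (suc d) (suc t) = spike d t

lookupD-twos : ∀ {k q} → q < k → lookupD (twos k) q ≡ two
lookupD-twos {suc k} {zero} _ = refl
lookupD-twos {suc k} {suc q} (s≤s q<k) = lookupD-twos q<k

lookupD-block : ∀ {k q} → q ≤ k → lookupD (block k) q ≡ spike 0 q
lookupD-block {k} {zero} _ = refl
lookupD-block {k} {suc q} q<k = lookupD-twos q<k

h-block : ∀ {J q} → q ≤ J → h (blockStart J + q) ≡ spike 0 q
h-block {J} {q} q≤J = begin
  lookupD (iter (suc i)) i
    ≡⟨ cong (λ w → lookupD w i) (trans (iter≡prefix (suc i)) eq) ⟩
  lookupD (prefix (suc J) ++ zs) i
    ≡⟨ lookupD-++ˡ (prefix (suc J)) zs inside ⟩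
  lookupD (prefix J ++ block J) i
    ≡⟨ cong (λ p → lookupD (prefix J ++ block J) (p + q)) (sym (length-prefix J)) ⟩
  lookupD (prefix J ++ block J) (length (prefix J) + q)
    ≡⟨ lookupD-++ʳ (prefix J) (block J) q ⟩
  lookupD (block J) q
    ≡⟨ lookupD-block q≤J ⟩
  spike 0 q ∎
  where
  open ≡-Reasoning
  i : ℕ
  i = blockStart J + q
  J≤i : suc J ≤ suc i
  J≤i = s≤s (≤-trans (k≤triangle J) (≤-trans (n≤1+n _) (m≤m+n (blockStart J) q)))
  zs : Word
  zs = proj₁ (prefix-mono J≤i)
  eq : prefix (suc i) ≡ prefix (suc J) ++ zs
  eq = proj₂ (prefix-mono J≤i)
  inside : i < length (prefix (suc J))
  inside = subst (i <_) (sym (length-prefix (suc J))) (s≤s (+-monoʳ-< (triangle J) (s≤s q≤J)))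

h-at : ∀ {p J q} → p ≡ blockStart J + q → q ≤ J → h p ≡ spike 0 q
h-at refl = h-block

next-position : ∀ {J q} → q ≤ J → ∃₂ λ J′ q′ → q′ ≤ J′ × suc (blockStart J + q) ≡ blockStart J′ + q′
next-position {J} {q} q≤J with m≤n⇒m<n∨m≡n q≤J
... | inj₁ q<J = J , suc q , q<J , sym (+-suc (blockStart J) q)
... | inj₂ refl = suc J , 0 , z≤n , trans (sym (+-suc (blockStart J) q)) (sym (+-identityʳ _))

block-position : (i : ℕ) → ∃₂ λ J r → r ≤ J × suc i ≡ blockStart J + r
block-position zero = 0 , 0 , z≤n , refl
block-position (suc i) with block-position i
... | J , r , r≤J , eq with next-position r≤J
...   | J′ , r′ , r′≤J′ , eq′ = J′ , r′ , r′≤J′ , trans (cong suc eq) eq′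

-- Factors as windows of h

window : (ℕ → Letter) → ℕ → Word
window f zero = []
window f (suc n) = f 0 ∷ window (λ t → f (suc t)) n

window-const : (a : Letter) (n : ℕ) → window (λ _ → a) n ≡ replicate n a
window-const a zero = refl
window-const a (suc n) = cong (a ∷_) (window-const a n)

window-cong : ∀ {f g} n → (∀ t → t < n → f t ≡ g t) → window f n ≡ window g n
window-cong zero _ = refl
window-cong (suc n) f≗g = cong₂ _∷_ (f≗g 0 z<s) (window-cong n λ t t<n → f≗g (suc t) (s≤s t<n))

spike-≢ : ∀ {d t} → t ≢ d → spike d t ≡ two
spike-≢ {zero} {zero} t≢d = ⊥-elim (t≢d refl)
spike-≢ {zero} {suc t} _ = refl
spike-≢ {suc d} {zero} _ = refl
spike-≢ {suc d} {suc t} t≢d = spike-≢ (λ t≡d → t≢d (cong suc t≡d))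

spike-before : ∀ {d t} → t < d → spike d t ≡ two
spike-before t<d = spike-≢ (<⇒≢ t<d)

spike-shift : (d y : ℕ) → spike d (d + y) ≡ spike 0 y
spike-shift zero y = refl
spike-shift (suc d) y = spike-shift d y

window-spike-beyond : ∀ {d d′} n → n ≤ d → n ≤ d′ → window (spike d) n ≡ window (spike d′) n
window-spike-beyond n n≤d n≤d′ = window-cong n λ t t<n →
  trans (spike-before (<-≤-trans t<n n≤d)) (sym (spike-before (<-≤-trans t<n n≤d′)))

window-spike : (d e : ℕ) → window (spike d) (d + suc e) ≡ twos d ++ one ∷ twos e
window-spike zero e = cong (one ∷_) (window-const two e)
window-spike (suc d) e = cong (two ∷_) (window-spike d e)

factor-window : ∀ {f} i n → (∀ t → t < n → h (i + t) ≡ f t) → factor i n ≡ window f n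
factor-window i zero _ = refl
factor-window i (suc n) hf = cong₂ _∷_
  (trans (cong h (sym (+-identityʳ i))) (hf 0 z<s))
  (factor-window (suc i) n λ t t<n → trans (cong h (sym (+-suc i t))) (hf (suc t) (s≤s t<n)))

factor-++ : (i a b : ℕ) → factor i (a + b) ≡ factor i a ++ factor (i + a) b
factor-++ i zero b = cong (λ p → factor p b) (sym (+-identityʳ i))
factor-++ i (suc a) b =
  cong (h i ∷_) (trans (factor-++ (suc i) a b) (cong (λ p → factor (suc i) a ++ factor p b) (sym (+-suc i a))))

factor-snoc : (i n : ℕ) → factor i (suc n) ≡ factor i n ++ h (i + n) ∷ []
factor-snoc i n = trans (cong (factor i) (+-comm 1 n)) (factor-++ i n 1)

length-factor : (i n : ℕ) → length (factor i n) ≡ n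
length-factor i zero = refl
length-factor i (suc n) = cong suc (length-factor (suc i) n)

factor-at-blockStart : ∀ {J n} → n ≤ suc J → factor (blockStart J) n ≡ window (spike 0) n
factor-at-blockStart {J} {n} n≤1+J = factor-window (blockStart J) n λ t t<n → h-block (≤-pred (<-≤-trans t<n n≤1+J))

factor-block : (J : ℕ) → factor (blockStart J) (suc J) ≡ block J
factor-block J = trans (factor-at-blockStart ≤-refl) (window-spike 0 J)

factor-prefix : (M : ℕ) → factor 0 (blockStart M) ≡ prefix M
factor-prefix zero = refl
factor-prefix (suc M) =
  trans (factor-++ 0 (blockStart M) (suc M)) (cong₂ _++_ (factor-prefix M) (factor-block M))

shift-to-next-block : ∀ T q d y → suc T + q + (suc d + y) ≡ suc (T + suc (q + d)) + y
shift-to-next-block = solve-∀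

factor-inside-block : ∀ {J q d n} → 1 ≤ q → q + d ≡ J → n ≤ suc d + suc (suc J) →
  factor (blockStart J + q) n ≡ window (spike (suc d)) n
factor-inside-block {J} {q} {d} {n} 1≤q refl n≤ = factor-window (blockStart J + q) n letter
  where
  letter : ∀ t → t < n → h (blockStart J + q + t) ≡ spike (suc d) t
  letter t t<n with ≤-<-connex (suc d) t
  ... | inj₂ t<1+d = begin
    h (blockStart J + q + t)   ≡⟨ cong h (+-assoc (blockStart J) q t) ⟩
    h (blockStart J + (q + t)) ≡⟨ h-block (+-monoʳ-≤ q (≤-pred t<1+d)) ⟩
    spike 0 (q + t)            ≡⟨ spike-≢ (>⇒≢ (≤-trans 1≤q (m≤m+n q t))) ⟩
    two                        ≡⟨ sym (spike-before t<1+d) ⟩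
    spike (suc d) t            ∎
    where open ≡-Reasoning
  ... | inj₁ 1+d≤t with m≤n⇒∃[o]m+o≡n 1+d≤t
  ...   | y , refl = begin
    h (blockStart J + q + (suc d + y)) ≡⟨ cong h (shift-to-next-block (triangle J) q d y) ⟩
    h (blockStart (suc J) + y)         ≡⟨ h-block (≤-pred (+-cancelˡ-< (suc d) y (suc (suc J)) (<-≤-trans t<n n≤))) ⟩
    spike 0 y                          ≡⟨ sym (spike-shift (suc d) y) ⟩
    spike (suc d) (suc d + y)          ∎
    where open ≡-Reasoning

blockStart-early : ∀ {J r n} → r ≤ J → J ≤ n → blockStart J + r < blockStart (suc n)
blockStart-early {J} r≤J J≤n =
  ≤-trans (+-monoʳ-< (blockStart J) (s≤s r≤J)) (s≤s (triangle-mono (s≤s J≤n)))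

spike-window-early : (d n : ℕ) → ∃ λ j → j < blockStart (suc n) × factor j n ≡ window (spike d) n
spike-window-early d zero = 0 , z<s , refl
spike-window-early zero (suc n) =
  blockStart (suc n) , subst (_< blockStart (suc (suc n))) (+-identityʳ _) (blockStart-early z≤n ≤-refl) ,
  factor-at-blockStart (n≤1+n (suc n))
spike-window-early (suc d) (suc n) with ≤-<-connex (suc d) (suc n)
... | inj₁ 1+d≤1+n with m≤n⇒∃[o]m+o≡n 1+d≤1+n
...   | o , e = blockStart (suc n) + suc o , blockStart-early o<1+n ≤-refl ,
  factor-inside-block (s≤s z≤n) (trans (cong suc (+-comm o d)) e)
    (≤-trans (≤-trans (n≤1+n _) (n≤1+n _)) (m≤n+m (suc (suc (suc n))) (suc d)))
  where
  o<1+n : suc o ≤ suc n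
  o<1+n = subst (suc o ≤_) e (s≤s (m≤n+m o d))
spike-window-early (suc d) (suc n) | inj₂ 1+n<1+d =
  blockStart (suc n) + 1 , blockStart-early (s≤s z≤n) ≤-refl ,
  trans (factor-inside-block ≤-refl refl (≤-trans (≤-trans (n≤1+n _) (n≤1+n _)) (m≤n+m (suc (suc (suc n))) (suc n))))
        (window-spike-beyond (suc n) ≤-refl (<⇒≤ 1+n<1+d))

far-factor-is-spike : ∀ {J r n} → r ≤ J → n < J → ∃ λ d → factor (blockStart J + r) n ≡ window (spike d) n
far-factor-is-spike {J} {zero} {n} _ n<J =
  0 , trans (cong (λ p → factor p n) (+-identityʳ _)) (factor-at-blockStart (≤-trans (<⇒≤ n<J) (n≤1+n J)))
far-factor-is-spike {J} {suc r} {n} r≤J n<J with m≤n⇒∃[o]m+o≡n r≤J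
... | d , e = suc d , factor-inside-block (s≤s z≤n) e
  (≤-trans (<⇒≤ n<J) (≤-trans (≤-trans (n≤1+n J) (n≤1+n _)) (m≤n+m (suc (suc J)) (suc d))))

factor-occurs-early : (n i : ℕ) → ∃ λ j → j < blockStart (suc n) × factor i n ≡ factor j n
factor-occurs-early n zero = 0 , z<s , refl
factor-occurs-early n (suc i) with block-position i
... | J , r , r≤J , e with ≤-<-connex J n
...   | inj₁ J≤n = suc i , subst (_< blockStart (suc n)) (sym e) (blockStart-early r≤J J≤n) , refl
...   | inj₂ n<J with far-factor-is-spike r≤J n<J
...     | d , f with spike-window-early d n
...       | j , j< , f′ = j , j< , trans (cong (λ p → factor p n) e) (trans f (sym f′))

-- Counting scattered subwords

[0] [1] [2] [12] [21] [121] : Word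
[0] = zero ∷ []
[1] = one ∷ []
[2] = two ∷ []
[12] = one ∷ two ∷ []
[21] = two ∷ one ∷ []
[121] = one ∷ two ∷ one ∷ []

binom-twos-0∷ : (c : ℕ) (y : Word) → binom (twos c) (zero ∷ y) ≡ 0
binom-twos-0∷ zero y = refl
binom-twos-0∷ (suc c) y = binom-twos-0∷ c y

binom-twos-1∷ : (c : ℕ) (y : Word) → binom (twos c) (one ∷ y) ≡ 0
binom-twos-1∷ zero y = refl
binom-twos-1∷ (suc c) y = binom-twos-1∷ c y

binom-twos-[2] : (c : ℕ) → binom (twos c) [2] ≡ c
binom-twos-[2] zero = refl
binom-twos-[2] (suc c) = cong suc (binom-twos-[2] c)

binom-twos-[21] : (c : ℕ) → binom (twos c) [21] ≡ 0
binom-twos-[21] zero = refl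
binom-twos-[21] (suc c) = cong₂ _+_ (binom-twos-1∷ c []) (binom-twos-[21] c)

binom-twos++-0∷ : (a : ℕ) (w y : Word) → binom (twos a ++ w) (zero ∷ y) ≡ binom w (zero ∷ y)
binom-twos++-0∷ zero w y = refl
binom-twos++-0∷ (suc a) w y = binom-twos++-0∷ a w y

binom-twos++-1∷ : (a : ℕ) (w y : Word) → binom (twos a ++ w) (one ∷ y) ≡ binom w (one ∷ y)
binom-twos++-1∷ zero w y = refl
binom-twos++-1∷ (suc a) w y = binom-twos++-1∷ a w y

binom-twos++-[2] : (a : ℕ) (w : Word) → binom (twos a ++ w) [2] ≡ a + binom w [2]
binom-twos++-[2] zero w = refl
binom-twos++-[2] (suc a) w = cong suc (binom-twos++-[2] a w)

binom-twos++-[21] : (a : ℕ) (w : Word) → binom (twos a ++ w) [21] ≡ a * binom w [1] + binom w [21]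
binom-twos++-[21] zero w = refl
binom-twos++-[21] (suc a) w =
  trans (cong₂ _+_ (binom-twos++-1∷ a w []) (binom-twos++-[21] a w)) (sym (+-assoc (binom w [1]) _ _))

binom-++-[1] : (u v : Word) → binom (u ++ v) [1] ≡ binom u [1] + binom v [1]
binom-++-[1] [] v = refl
binom-++-[1] (zero ∷ u) v = binom-++-[1] u v
binom-++-[1] (suc zero ∷ u) v = cong suc (binom-++-[1] u v)
binom-++-[1] (suc (suc zero) ∷ u) v = binom-++-[1] u v

module _ (c : ℕ) where

  binom-++twos-[0] : (w : Word) → binom (w ++ twos c) [0] ≡ binom w [0]
  binom-++twos-[0] [] = binom-twos-0∷ c []
  binom-++twos-[0] (zero ∷ w) = cong suc (binom-++twos-[0] w)
  binom-++twos-[0] (suc zero ∷ w) = binom-++twos-[0] w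
  binom-++twos-[0] (suc (suc zero) ∷ w) = binom-++twos-[0] w

  binom-++twos-[1] : (w : Word) → binom (w ++ twos c) [1] ≡ binom w [1]
  binom-++twos-[1] w = trans (binom-++-[1] w (twos c)) (trans (cong (binom w [1] +_) (binom-twos-1∷ c [])) (+-identityʳ _))

  binom-++twos-[2] : (w : Word) → binom (w ++ twos c) [2] ≡ binom w [2] + c
  binom-++twos-[2] [] = binom-twos-[2] c
  binom-++twos-[2] (zero ∷ w) = binom-++twos-[2] w
  binom-++twos-[2] (suc zero ∷ w) = binom-++twos-[2] w
  binom-++twos-[2] (suc (suc zero) ∷ w) = cong suc (binom-++twos-[2] w)

  binom-++twos-[21] : (w : Word) → binom (w ++ twos c) [21] ≡ binom w [21]
  binom-++twos-[21] [] = binom-twos-[21] c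
  binom-++twos-[21] (zero ∷ w) = binom-++twos-[21] w
  binom-++twos-[21] (suc zero ∷ w) = binom-++twos-[21] w
  binom-++twos-[21] (suc (suc zero) ∷ w) = cong₂ _+_ (binom-++twos-[1] w) (binom-++twos-[21] w)

  binom-++twos-[12] : (w : Word) → binom (w ++ twos c) [12] ≡ binom w [12] + binom w [1] * c
  binom-++twos-[12] [] = binom-twos-1∷ c [2]
  binom-++twos-[12] (zero ∷ w) = binom-++twos-[12] w
  binom-++twos-[12] (suc zero ∷ w) = begin
    binom (w ++ twos c) [2] + binom (w ++ twos c) [12]
      ≡⟨ cong₂ _+_ (binom-++twos-[2] w) (binom-++twos-[12] w) ⟩
    (binom w [2] + c) + (binom w [12] + binom w [1] * c)
      ≡⟨ regroup (binom w [2]) (binom w [12]) (binom w [1]) c ⟩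
    (binom w [2] + binom w [12]) + suc (binom w [1]) * c ∎
    where
    open ≡-Reasoning
    regroup : ∀ x y z c → (x + c) + (y + z * c) ≡ (x + y) + suc z * c
    regroup = solve-∀
  binom-++twos-[12] (suc (suc zero) ∷ w) = binom-++twos-[12] w

  binom-++twos-[121] : (w : Word) → binom (w ++ twos c) [121] ≡ binom w [121]
  binom-++twos-[121] [] = binom-twos-1∷ c _
  binom-++twos-[121] (zero ∷ w) = binom-++twos-[121] w
  binom-++twos-[121] (suc zero ∷ w) = cong₂ _+_ (binom-++twos-[21] w) (binom-++twos-[121] w)
  binom-++twos-[121] (suc (suc zero) ∷ w) = binom-++twos-[121] w

binom-prefix-[1] : (M : ℕ) → binom (prefix M) [1] ≡ M
binom-prefix-[1] zero = refl
binom-prefix-[1] (suc M) = trans (binom-++-[1] (prefix M) (block M))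
  (trans (cong₂ _+_ (binom-prefix-[1] M) (cong suc (binom-twos-1∷ M []))) (+-comm M 1))

binom-[aa] : (w : Word) (a : Letter) → binom w (a ∷ a ∷ []) ≡ binom w (a ∷ []) C 2
binom-[aa] [] a = refl
binom-[aa] (c ∷ w) a with c Fin.≟ a
... | yes _ = trans (cong₂ _+_ (sym (nC1≡n (binom w (a ∷ [])))) (binom-[aa] w a))
  (nCk+nC[k+1]≡[n+1]C[k+1] (binom w (a ∷ [])) 1)
... | no _ = binom-[aa] w a

binom-[ab]+[ba] : (w : Word) {a b : Letter} → a ≢ b →
  binom w (a ∷ b ∷ []) + binom w (b ∷ a ∷ []) ≡ binom w (a ∷ []) * binom w (b ∷ [])
binom-[ab]+[ba] [] _ = refl
binom-[ab]+[ba] (c ∷ w) {a} {b} a≢b with c Fin.≟ a | c Fin.≟ b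
... | yes refl | yes refl = ⊥-elim (a≢b refl)
... | yes _ | no _ = trans (+-assoc (binom w (b ∷ [])) _ _) (cong (binom w (b ∷ []) +_) (binom-[ab]+[ba] w a≢b))
... | no _ | no _ = binom-[ab]+[ba] w a≢b
... | no _ | yes _ = begin
  ab + (x + ba)   ≡⟨ +-exchange ab x ba ⟩
  x + (ab + ba)   ≡⟨ cong (x +_) (binom-[ab]+[ba] w a≢b) ⟩
  x + x * y       ≡⟨ sym (*-suc x y) ⟩
  x * suc y       ∎
  where
  open ≡-Reasoning
  x = binom w (a ∷ [])
  y = binom w (b ∷ [])
  ab = binom w (a ∷ b ∷ [])
  ba = binom w (b ∷ a ∷ [])
  +-exchange : ∀ p q r → p + (q + r) ≡ q + (p + r)
  +-exchange = solve-∀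

binom-0-free : (w : Word) → binom w [0] ≡ 0 → (a : Letter) →
  binom w (zero ∷ a ∷ []) ≡ 0 × binom w (a ∷ zero ∷ []) ≡ 0
binom-0-free w no-0 zero = trans (binom-[aa] w zero) (cong (_C 2) no-0) , trans (binom-[aa] w zero) (cong (_C 2) no-0)
binom-0-free w no-0 (suc a) = m+n≡0⇒m≡0 _ both , m+n≡0⇒n≡0 _ both
  where
  both : binom w (zero ∷ suc a ∷ []) + binom w (suc a ∷ zero ∷ []) ≡ 0
  both = trans (binom-[ab]+[ba] w (λ ())) (cong (_* binom w (suc a ∷ [])) no-0)

-- Binomial equivalence

all-short? : (Q : Word → Set) → (∀ x → Dec (Q x)) → (j : ℕ) → Dec (∀ x → length x ≤ j → Q x)
all-short? Q Q? zero with Q? []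
... | yes q = yes λ { [] _ → q ; (_ ∷ _) () }
... | no ¬q = no λ all → ¬q (all [] z≤n)
all-short? Q Q? (suc j) with Q? [] | Fin.all? (λ a → all-short? (λ y → Q (a ∷ y)) (λ y → Q? (a ∷ y)) j)
... | yes q | yes all-a = yes λ { [] _ → q ; (a ∷ y) (s≤s p) → all-a a y p }
... | no ¬q | _ = no λ all → ¬q (all [] z≤n)
... | _ | no ¬all-a = no λ all → ¬all-a λ a y p → all (a ∷ y) (s≤s p)

∼-isDecEquivalence : (j : ℕ) → IsDecEquivalence (λ u v → u ∼[ j ] v)
∼-isDecEquivalence j = record
  { isEquivalence = record
    { refl = λ _ _ → refl
    ; sym = λ r x p → sym (r x p)
    ; trans = λ r r′ x p → trans (r x p) (r′ x p)
    }
  ; _≟_ = λ u v → all-short? (λ x → binom u x ≡ binom v x) (λ x → binom u x ≟ binom v x) j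
  }

∼-isEquivalence : (j : ℕ) → IsEquivalence (λ u v → u ∼[ j ] v)
∼-isEquivalence j = IsDecEquivalence.isEquivalence (∼-isDecEquivalence j)

∼-weaken : ∀ {i j u v} → i ≤ j → u ∼[ j ] v → u ∼[ i ] v
∼-weaken i≤j r x p = r x (≤-trans p i≤j)

∼₁-intro : (u v : Word) → binom u [0] ≡ binom v [0] → binom u [1] ≡ binom v [1] → binom u [2] ≡ binom v [2] →
  u ∼[ 1 ] v
∼₁-intro _ _ _ _ _ [] _ = refl
∼₁-intro _ _ e₀ _ _ (zero ∷ []) _ = e₀
∼₁-intro _ _ _ e₁ _ (suc zero ∷ []) _ = e₁
∼₁-intro _ _ _ _ e₂ (suc (suc zero) ∷ []) _ = e₂
∼₁-intro _ _ _ _ _ (_ ∷ _ ∷ _) (s≤s ())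

∼₂-intro : (u v : Word) → binom u [0] ≡ 0 → binom v [0] ≡ 0 →
  binom u [1] ≡ binom v [1] → binom u [2] ≡ binom v [2] → binom u [12] ≡ binom v [12] → u ∼[ 2 ] v
∼₂-intro u v u₀ v₀ e₁ e₂ e₁₂ = same
  where
  same : u ∼[ 2 ] v
  same [] _ = refl
  same (a ∷ []) _ = ∼₁-intro u v (trans u₀ (sym v₀)) e₁ e₂ (a ∷ []) (s≤s z≤n)
  same (zero ∷ a ∷ []) _ = trans (proj₁ (binom-0-free u u₀ a)) (sym (proj₁ (binom-0-free v v₀ a)))
  same (suc a ∷ zero ∷ []) _ = trans (proj₂ (binom-0-free u u₀ (suc a))) (sym (proj₂ (binom-0-free v v₀ (suc a))))
  same (suc zero ∷ suc zero ∷ []) _ = trans (binom-[aa] u one) (trans (cong (_C 2) e₁) (sym (binom-[aa] v one)))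
  same (suc (suc zero) ∷ suc (suc zero) ∷ []) _ = trans (binom-[aa] u two) (trans (cong (_C 2) e₂) (sym (binom-[aa] v two)))
  same (suc zero ∷ suc (suc zero) ∷ []) _ = e₁₂
  same (suc (suc zero) ∷ suc zero ∷ []) _ = +-cancelˡ-≡ (binom u [12]) _ _ (begin
    binom u [12] + binom u [21] ≡⟨ binom-[ab]+[ba] u (λ ()) ⟩
    binom u [1] * binom u [2]   ≡⟨ cong₂ _*_ e₁ e₂ ⟩
    binom v [1] * binom v [2]   ≡⟨ sym (binom-[ab]+[ba] v (λ ())) ⟩
    binom v [12] + binom v [21] ≡⟨ cong (_+ binom v [21]) (sym e₁₂) ⟩
    binom u [12] + binom v [21] ∎)
    where open ≡-Reasoning
  same (_ ∷ _ ∷ _ ∷ _) (s≤s (s≤s ()))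

-- Factors are determined by their subwords of length at most 3

staircase : ℕ → ℕ → Word
staircase j zero = one ∷ []
staircase j (suc m) = block j ++ staircase (suc j) m

staircase-snoc : (j m : ℕ) → staircase j (suc m) ≡ staircase j m ++ twos (j + m) ++ one ∷ []
staircase-snoc j zero = cong (λ k → block k ++ one ∷ []) (sym (+-identityʳ j))
staircase-snoc j (suc m) = cong (one ∷_) (begin
  twos j ++ staircase (suc j) (suc m)
    ≡⟨ cong (twos j ++_) (staircase-snoc (suc j) m) ⟩
  twos j ++ staircase (suc j) m ++ twos (suc j + m) ++ one ∷ []
    ≡⟨ sym (++-assoc (twos j) (staircase (suc j) m) _) ⟩
  (twos j ++ staircase (suc j) m) ++ twos (suc j + m) ++ one ∷ []
    ≡⟨ cong (λ k → (twos j ++ staircase (suc j) m) ++ twos k ++ one ∷ []) (sym (+-suc j m)) ⟩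
  (twos j ++ staircase (suc j) m) ++ twos (j + suc m) ++ one ∷ [] ∎)
  where open ≡-Reasoning

padded : ℕ → ℕ → ℕ → ℕ → Word
padded a j m c = twos a ++ staircase j m ++ twos c

padded-snoc-two : (a j m c : ℕ) → padded a j m c ++ two ∷ [] ≡ padded a j m (suc c)
padded-snoc-two a j m c = begin
  (twos a ++ staircase j m ++ twos c) ++ two ∷ [] ≡⟨ ++-assoc (twos a) _ _ ⟩
  twos a ++ (staircase j m ++ twos c) ++ two ∷ [] ≡⟨ cong (twos a ++_) (++-assoc (staircase j m) _ _) ⟩
  twos a ++ staircase j m ++ twos c ++ two ∷ []   ≡⟨ cong (λ w → twos a ++ staircase j m ++ w) (twos-snoc c) ⟩
  twos a ++ staircase j m ++ twos (suc c)         ∎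
  where open ≡-Reasoning

padded-snoc-one : (a j m : ℕ) → padded a j m (j + m) ++ one ∷ [] ≡ padded a j (suc m) 0
padded-snoc-one a j m = begin
  (twos a ++ staircase j m ++ twos (j + m)) ++ one ∷ [] ≡⟨ ++-assoc (twos a) _ _ ⟩
  twos a ++ (staircase j m ++ twos (j + m)) ++ one ∷ [] ≡⟨ cong (twos a ++_) (++-assoc (staircase j m) _ _) ⟩
  twos a ++ staircase j m ++ twos (j + m) ++ one ∷ []   ≡⟨ cong (twos a ++_) (sym (staircase-snoc j m)) ⟩
  twos a ++ staircase j (suc m)                         ≡⟨ cong (twos a ++_) (sym (++-identityʳ _)) ⟩
  twos a ++ staircase j (suc m) ++ []                   ∎
  where open ≡-Reasoning

data FactorShape (i n : ℕ) : Set where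
  within-block : (J q : ℕ) → q ≤ J → i + n ≡ blockStart J + q →
    factor i n ≡ twos n → FactorShape i n
  across-blocks : (a j m c : ℕ) → i + n ≡ blockStart (j + m) + suc c → c ≤ j + m →
    factor i n ≡ padded a j m c → FactorShape i n

factor-snoc-at : ∀ {i n} J {q} → i + n ≡ blockStart J + q → q ≤ J → factor i (suc n) ≡ factor i n ++ spike 0 q ∷ []
factor-snoc-at {i} {n} J e q≤J = trans (factor-snoc i n) (cong (λ a → factor i n ++ a ∷ []) (h-at e q≤J))

next-start : ∀ {i n} J → i + n ≡ blockStart J + 0 → i + suc n ≡ blockStart J + 1
next-start {i} {n} J e = trans (+-suc i n) (trans (cong suc e) (sym (+-suc (blockStart J) 0)))

extend-within-block : ∀ {i n J q} → q ≤ J → i + n ≡ blockStart J + q → factor i n ≡ twos n →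
  FactorShape i (suc n)
extend-within-block {i} {n} {J} {zero} _ e f =
  across-blocks n J 0 0
    (trans (next-start J e) (cong (λ k → blockStart k + 1) (sym (+-identityʳ J)))) z≤n
    (trans (factor-snoc-at J e z≤n) (cong (_++ one ∷ []) f))
extend-within-block {i} {n} {J} {suc q} q≤J e f with next-position q≤J
... | J′ , q′ , q′≤J′ , e′ =
  within-block J′ q′ q′≤J′ (trans (+-suc i n) (trans (cong suc e) e′))
    (trans (factor-snoc-at J e q≤J) (trans (cong (_++ two ∷ []) f) (twos-snoc n)))

extend-across-blocks : ∀ {i n a j m c} → i + n ≡ blockStart (j + m) + suc c →
  c ≤ j + m → factor i n ≡ padded a j m c → FactorShape i (suc n)
extend-across-blocks {i} {n} {a} {j} {m} {c} e c≤ f with m≤n⇒m<n∨m≡n c≤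
... | inj₁ c< =
  across-blocks a j m (suc c) (trans (+-suc i n) (trans (cong suc e) (sym (+-suc (blockStart (j + m)) (suc c))))) c<
    (trans (factor-snoc-at (j + m) e c<) (trans (cong (_++ two ∷ []) f) (padded-snoc-two a j m c)))
... | inj₂ refl =
  across-blocks a j (suc m) 0
    (trans (next-start (suc (j + m)) at-next) (cong (λ k → blockStart k + 1) (sym (+-suc j m)))) z≤n
    (trans (factor-snoc-at (suc (j + m)) at-next z≤n) (trans (cong (_++ one ∷ []) f) (padded-snoc-one a j m)))
  where
  at-next : i + n ≡ blockStart (suc (j + m)) + 0
  at-next = trans e (sym (+-identityʳ _))

shape : (i n : ℕ) → FactorShape (suc i) n
shape i zero with block-position i
... | J , r , r≤J , eq = within-block J r r≤J (trans (+-identityʳ (suc i)) eq) refl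
shape i (suc n) with shape i n
... | within-block J q q≤J e f = extend-within-block {J = J} {q} q≤J e f
... | across-blocks a j m c e c≤ f = extend-across-blocks {a = a} {j} {m} {c} e c≤ f

binom-staircase-[0] : (j m : ℕ) → binom (staircase j m) [0] ≡ 0
binom-staircase-[0] j zero = refl
binom-staircase-[0] j (suc m) = trans (binom-twos++-0∷ j _ []) (binom-staircase-[0] (suc j) m)

binom-staircase-[1] : (j m : ℕ) → binom (staircase j m) [1] ≡ suc m
binom-staircase-[1] j zero = refl
binom-staircase-[1] j (suc m) = cong suc (trans (binom-twos++-1∷ j _ []) (binom-staircase-[1] (suc j) m))

binom-staircase-[21] : (j m : ℕ) →
  binom (staircase j (suc m)) [21] ≡ j * suc m + binom (staircase (suc j) m) [21]
binom-staircase-[21] j m = trans (binom-twos++-[21] j (staircase (suc j) m))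
  (cong (λ k → j * k + binom (staircase (suc j) m) [21]) (binom-staircase-[1] (suc j) m))

binom-staircase-[121] : (j m : ℕ) →
  binom (staircase j (suc m)) [121] ≡ binom (staircase j (suc m)) [21] + binom (staircase (suc j) m) [121]
binom-staircase-[121] j m = cong (binom (staircase j (suc m)) [21] +_) (binom-twos++-1∷ j _ _)

binom-staircase-[21]-mono : (m : ℕ) {j j′ : ℕ} → j ≤ j′ →
  binom (staircase j m) [21] ≤ binom (staircase j′ m) [21]
binom-staircase-[21]-mono zero _ = z≤n
binom-staircase-[21]-mono (suc m) {j} {j′} j≤j′
  rewrite binom-staircase-[21] j m | binom-staircase-[21] j′ m =
  +-mono-≤ (*-monoˡ-≤ (suc m) j≤j′) (binom-staircase-[21]-mono m (s≤s j≤j′))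

binom-staircase-[121]-mono : (m : ℕ) {j j′ : ℕ} → j ≤ j′ →
  binom (staircase j m) [121] ≤ binom (staircase j′ m) [121]
binom-staircase-[121]-mono zero _ = z≤n
binom-staircase-[121]-mono (suc m) {j} {j′} j≤j′
  rewrite binom-staircase-[121] j m | binom-staircase-[121] j′ m =
  +-mono-≤ (binom-staircase-[21]-mono (suc m) j≤j′) (binom-staircase-[121]-mono m (s≤s j≤j′))

binom-staircase-[121]-strict : (m : ℕ) {j j′ : ℕ} → j < j′ →
  binom (staircase j (suc m)) [121] < binom (staircase j′ (suc m)) [121]
binom-staircase-[121]-strict m {j} {j′} j<j′
  rewrite binom-staircase-[121] j m | binom-staircase-[121] j′ m
        | binom-staircase-[21] j m | binom-staircase-[21] j′ m =
  +-mono-<-≤ (+-mono-<-≤ (*-monoˡ-< (suc m) j<j′) (binom-staircase-[21]-mono m (s≤s (<⇒≤ j<j′))))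
             (binom-staircase-[121]-mono m (s≤s (<⇒≤ j<j′)))

staircase-injective : (m : ℕ) {j j′ : ℕ} →
  binom (staircase j m) [121] ≡ binom (staircase j′ m) [121] → staircase j m ≡ staircase j′ m
staircase-injective zero _ = refl
staircase-injective (suc m) {j} {j′} eq with <-cmp j j′
... | tri< j<j′ _ _ = ⊥-elim (<⇒≢ (binom-staircase-[121]-strict m j<j′) eq)
... | tri≈ _ refl _ = refl
... | tri> _ _ j′<j = ⊥-elim (<⇒≢ (binom-staircase-[121]-strict m j′<j) (sym eq))

module _ (a j m c : ℕ) where

  binom-padded-[0] : binom (padded a j m c) [0] ≡ 0
  binom-padded-[0] = trans (binom-twos++-0∷ a _ []) (trans (binom-++twos-[0] c (staircase j m)) (binom-staircase-[0] j m))

  binom-padded-[1] : binom (padded a j m c) [1] ≡ suc m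
  binom-padded-[1] = trans (binom-twos++-1∷ a _ []) (trans (binom-++twos-[1] c (staircase j m)) (binom-staircase-[1] j m))

  binom-padded-[12] : binom (padded a j m c) [12] ≡ binom (staircase j m) [12] + suc m * c
  binom-padded-[12] = trans (binom-twos++-1∷ a _ _) (trans (binom-++twos-[12] c (staircase j m))
    (cong (λ k → binom (staircase j m) [12] + k * c) (binom-staircase-[1] j m)))

  binom-padded-[121] : binom (padded a j m c) [121] ≡ binom (staircase j m) [121]
  binom-padded-[121] = trans (binom-twos++-1∷ a _ _) (binom-++twos-[121] c (staircase j m))

  length-padded : length (padded a j m c) ≡ a + (length (staircase j m) + c)
  length-padded = trans (length-++ (twos a)) (cong₂ _+_ (length-replicate a)
    (trans (length-++ (staircase j m)) (cong (length (staircase j m) +_) (length-replicate c))))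

padded-injective : ∀ {a j m c a′ j′ m′ c′} →
  length (padded a j m c) ≡ length (padded a′ j′ m′ c′) →
  binom (padded a j m c) [1] ≡ binom (padded a′ j′ m′ c′) [1] →
  binom (padded a j m c) [12] ≡ binom (padded a′ j′ m′ c′) [12] →
  binom (padded a j m c) [121] ≡ binom (padded a′ j′ m′ c′) [121] →
  padded a j m c ≡ padded a′ j′ m′ c′
padded-injective {a} {j} {m} {c} {a′} {j′} {m′} {c′} e e₁ e₁₂ e₁₂₁
  with suc-injective (trans (sym (binom-padded-[1] a j m c)) (trans e₁ (binom-padded-[1] a′ j′ m′ c′)))
... | refl = cong₂ (λ x w → twos x ++ w) same-a (cong₂ _++_ stairs (cong twos same-c))
  where
  stairs : staircase j m ≡ staircase j′ m
  stairs = staircase-injective m (trans (sym (binom-padded-[121] a j m c))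
    (trans e₁₂₁ (binom-padded-[121] a′ j′ m c′)))
  same-c : c ≡ c′
  same-c = *-cancelˡ-≡ c c′ (suc m) (+-cancelˡ-≡ (binom (staircase j m) [12]) _ _
    (trans (sym (binom-padded-[12] a j m c)) (trans e₁₂
      (trans (binom-padded-[12] a′ j′ m c′) (cong (λ w → binom w [12] + suc m * c′) (sym stairs))))))
  same-a : a ≡ a′
  same-a = +-cancelʳ-≡ (length (staircase j m) + c) a a′
    (trans (sym (length-padded a j m c)) (trans e
      (trans (length-padded a′ j′ m c′) (cong₂ (λ w k → a′ + (length w + k)) (sym stairs) (sym same-c)))))

binom-factor-[0] : (i n : ℕ) → binom (factor (suc i) n) [0] ≡ 0
binom-factor-[0] i n with shape i n
... | within-block _ _ _ _ f = trans (cong (λ w → binom w [0]) f) (binom-twos-0∷ n [])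
... | across-blocks a j m c _ _ f = trans (cong (λ w → binom w [0]) f) (binom-padded-[0] a j m c)

twos≁₁padded : ∀ {n} a j m c → ¬ twos n ∼[ 1 ] padded a j m c
twos≁₁padded {n} a j m c r =
  0≢1+n (trans (sym (binom-twos-1∷ n [])) (trans (r [1] (s≤s z≤n)) (binom-padded-[1] a j m c)))

shapes-∼₃⇒≡ : ∀ {i i′ n} → FactorShape i n → FactorShape i′ n →
  factor i n ∼[ 3 ] factor i′ n → factor i n ≡ factor i′ n
shapes-∼₃⇒≡ (within-block _ _ _ _ f) (within-block _ _ _ _ f′) _ = trans f (sym f′)
shapes-∼₃⇒≡ (within-block _ _ _ _ f) (across-blocks a j m c _ _ f′) r =
  ⊥-elim (twos≁₁padded a j m c (∼-weaken (s≤s z≤n) (subst₂ (λ u v → u ∼[ 3 ] v) f f′ r)))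
shapes-∼₃⇒≡ (across-blocks a j m c _ _ f) (within-block _ _ _ _ f′) r =
  ⊥-elim (twos≁₁padded a j m c (∼-weaken (s≤s z≤n) (subst₂ (λ u v → u ∼[ 3 ] v) f′ f (λ x p → sym (r x p)))))
shapes-∼₃⇒≡ {i} {i′} {n} (across-blocks a j m c _ _ f) (across-blocks a′ j′ m′ c′ _ _ f′) r =
  trans f (trans (padded-injective {a} {j} {m} {c} {a′} {j′} {m′} {c′} same-length
    (r′ [1] (s≤s z≤n)) (r′ [12] (s≤s (s≤s z≤n))) (r′ [121] ≤-refl)) (sym f′))
  where
  r′ : padded a j m c ∼[ 3 ] padded a′ j′ m′ c′
  r′ = subst₂ (λ u v → u ∼[ 3 ] v) f f′ r
  same-length : length (padded a j m c) ≡ length (padded a′ j′ m′ c′)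
  same-length = trans (cong length (sym f)) (trans (length-factor i n) (trans (sym (length-factor i′ n)) (cong length f′)))

factor-∼₃⇒≡ : (i i′ n : ℕ) → factor i n ∼[ 3 ] factor i′ n → factor i n ≡ factor i′ n
factor-∼₃⇒≡ zero zero n _ = refl
factor-∼₃⇒≡ zero (suc i′) zero _ = refl
factor-∼₃⇒≡ zero (suc i′) (suc n) r = ⊥-elim (1+n≢0 (trans (r [0] (s≤s z≤n)) (binom-factor-[0] i′ (suc n))))
factor-∼₃⇒≡ (suc i) zero zero _ = refl
factor-∼₃⇒≡ (suc i) zero (suc n) r = ⊥-elim (1+n≢0 (trans (sym (r [0] (s≤s z≤n))) (binom-factor-[0] i (suc n))))
factor-∼₃⇒≡ (suc i) (suc i′) n r = shapes-∼₃⇒≡ (shape i n) (shape i′ n) r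

-- Counting equivalence classes of factors

Separated : (Word → Word → Set) → ℕ → ∀ {k} → (Fin k → ℕ) → Set
Separated R n pos = ∀ a b → a ≢ b → ¬ R (factor (pos a) n) (factor (pos b) n)

module _ {R : Word → Word → Set} (R-isEquivalence : IsEquivalence R) where
  private module R = IsEquivalence R-isEquivalence

  classCount-≥ : ∀ {n k m} → ClassCount R n k → (p : Fin m → ℕ) → Separated R n p → m ≤ k
  classCount-≥ {n} (pos , _ , cover) p sep-p = Fin.injective⇒≤ class-injective
    where
    class-injective : ∀ {a b} → proj₁ (cover (p a)) ≡ proj₁ (cover (p b)) → a ≡ b
    class-injective {a} {b} same with a Fin.≟ b
    ... | yes a≡b = a≡b
    ... | no a≢b = ⊥-elim (sep-p a b a≢b (R.trans (proj₂ (cover (p a)))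
      (subst (λ c → R (factor (pos c) n) (factor (p b) n)) (sym same) (R.sym (proj₂ (cover (p b)))))))

module _ {R : Word → Word → Set} (R-isDecEquivalence : IsDecEquivalence R) (n : ℕ) where
  private module R = IsDecEquivalence R-isDecEquivalence

  classes-below : (p : ℕ) → ∃ λ k → Σ (Fin k → ℕ) λ pos →
    Separated R n pos × (∀ i → i < p → ∃ λ a → R (factor i n) (factor (pos a) n))
  classes-below zero = 0 , (λ ()) , (λ ()) , λ _ ()
  classes-below (suc p) with classes-below p
  ... | k , pos , sep , cover with Fin.any? (λ a → factor p n R.≟ factor (pos a) n)
  ...   | yes (a , r) = k , pos , sep , cover′
    where
    cover′ : ∀ i → i < suc p → ∃ λ a → R (factor i n) (factor (pos a) n)
    cover′ i i≤p with m≤n⇒m<n∨m≡n (≤-pred i≤p)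
    ... | inj₁ i<p = cover i i<p
    ... | inj₂ refl = a , r
  ...   | no new = suc k , pos′ , sep′ , cover′
    where
    pos′ : Fin (suc k) → ℕ
    pos′ zero = p
    pos′ (suc a) = pos a
    sep′ : Separated R n pos′
    sep′ zero zero 0≢0 _ = 0≢0 refl
    sep′ zero (suc b) _ r = new (b , r)
    sep′ (suc a) zero _ r = new (a , R.sym r)
    sep′ (suc a) (suc b) a≢b = sep a b (λ a≡b → a≢b (cong suc a≡b))
    cover′ : ∀ i → i < suc p → ∃ λ a → R (factor i n) (factor (pos′ a) n)
    cover′ i i≤p with m≤n⇒m<n∨m≡n (≤-pred i≤p)
    ... | inj₁ i<p = suc (proj₁ (cover i i<p)) , proj₂ (cover i i<p)
    ... | inj₂ refl = zero , R.refl

  classCount-exists : (Q : ℕ) → (∀ i → ∃ λ j → j < Q × factor i n ≡ factor j n) → ∃ (ClassCount R n)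
  classCount-exists Q early with classes-below Q
  ... | k , pos , sep , cover = k , pos , sep , λ i → let j , j<Q , i≈j = early i in
    subst (λ w → ∃ λ a → R w (factor (pos a) n)) (sym i≈j) (cover j j<Q)

module _ {R R′ : Word → Word → Set} (R-isEquivalence : IsEquivalence R) (R′-isEquivalence : IsEquivalence R′)
         (R′⇒R : ∀ {u v} → R′ u v → R u v) where
  private
    module R = IsEquivalence R-isEquivalence
    module R′ = IsEquivalence R′-isEquivalence

  classCount-< : ∀ {n k l} → ClassCount R n k → ClassCount R′ n l → ∀ i j →
    R (factor i n) (factor j n) → ¬ R′ (factor i n) (factor j n) → k < l
  classCount-< {n} {k} (pos , sep , cover) cc′ i j i~j i≁j = classCount-≥ R′-isEquivalence cc′ family separated
    where
    -- The R-representatives, with that of the class of i replaced by i itself, together with j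
    -- are k + 1 pairwise R′-inequivalent factors.
    a₀ : Fin k
    a₀ = proj₁ (cover i)
    rep : Fin k → ℕ
    rep a with a Fin.≟ a₀
    ... | yes _ = i
    ... | no _ = pos a
    rep~pos : ∀ a → R (factor (rep a) n) (factor (pos a) n)
    rep~pos a with a Fin.≟ a₀
    ... | yes refl = proj₂ (cover i)
    ... | no _ = R.refl
    j≁rep : ∀ a → ¬ R′ (factor j n) (factor (rep a) n)
    j≁rep a with a Fin.≟ a₀
    ... | yes _ = λ r → i≁j (R′.sym r)
    ... | no a≢a₀ = λ r → sep a₀ a (λ a₀≡a → a≢a₀ (sym a₀≡a))
      (R.trans (R.sym (proj₂ (cover i))) (R.trans i~j (R′⇒R r)))
    family : Fin (suc k) → ℕ
    family zero = j
    family (suc a) = rep a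
    separated : Separated R′ n family
    separated zero zero 0≢0 _ = 0≢0 refl
    separated zero (suc b) _ = j≁rep b
    separated (suc a) zero _ r = j≁rep a (R′.sym r)
    separated (suc a) (suc b) a≢b r = sep a b (λ a≡b → a≢b (cong suc a≡b))
      (R.trans (R.sym (rep~pos a)) (R.trans (R′⇒R r) (rep~pos b)))

binomComplexity-exists : (j n : ℕ) → ∃ (BinomComplexity j n)
binomComplexity-exists j n =
  classCount-exists (∼-isDecEquivalence j) n (blockStart (suc n)) (factor-occurs-early n)

binomComplexity-≺ : ∀ {j} →
  (∀ N → ∃ λ n → N ≤ n × ∃₂ λ p q → factor p n ∼[ j ] factor q n × ¬ factor p n ∼[ suc j ] factor q n) →
  BinomComplexity j ≺ BinomComplexity (suc j)
binomComplexity-≺ {j} witness N =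
  let n , N≤n , p , q , p∼q , p≁q = witness N
      k , ccₖ = binomComplexity-exists j n
      l , ccₗ = binomComplexity-exists (suc j) n
  in n , N≤n , k , l , ccₖ , ccₗ ,
     classCount-< (∼-isEquivalence j) (∼-isEquivalence (suc j)) (∼-weaken (n≤1+n j)) ccₖ ccₗ p q p∼q p≁q

binomComplexity-3≡factorComplexity : (n : ℕ) → ∃ λ k → BinomComplexity 3 n k × FactorComplexity n k
binomComplexity-3≡factorComplexity n with binomComplexity-exists 3 n
... | k , pos , sep , cover = k , (pos , sep , cover) ,
  (pos , (λ a b a≢b same → sep a b a≢b (λ x _ → cong (λ w → binom w x) same)) ,
   λ i → proj₁ (cover i) , factor-∼₃⇒≡ i (pos (proj₁ (cover i))) n (proj₂ (cover i)))

discrete-intermediate-value : (f : ℕ → ℕ) → (∀ i → f i ≤ suc (f (suc i))) →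
  ∀ d i t → t ≤ f i → f (i + d) ≤ t → ∃ λ p → f p ≡ t
discrete-intermediate-value f step zero i t t≤fi fi≤t =
  i , ≤-antisym (subst (λ p → f p ≤ t) (+-identityʳ i) fi≤t) t≤fi
discrete-intermediate-value f step (suc d) i t t≤fi fi+d≤t with <-≤-connex (f (suc i)) t
... | inj₁ f1+i<t = i , ≤-antisym (≤-trans (step i) f1+i<t) t≤fi
... | inj₂ t≤f1+i = discrete-intermediate-value f step d (suc i) t t≤f1+i (subst (λ p → f p ≤ t) (+-suc i d) fi+d≤t)

ones-step : (n i : ℕ) → binom (factor i n) [1] ≤ suc (binom (factor (suc i) n) [1])
ones-step zero i = z≤n
ones-step (suc n) i = ≤-trans (head-step (h i) (factor (suc i) n)) (s≤s (begin
  binom (factor (suc i) n) [1]                          ≤⟨ m≤m+n _ _ ⟩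
  binom (factor (suc i) n) [1] + binom (h (suc i + n) ∷ []) [1] ≡⟨ sym (binom-++-[1] (factor (suc i) n) _) ⟩
  binom (factor (suc i) n ++ h (suc i + n) ∷ []) [1]    ≡⟨ cong (λ w → binom w [1]) (sym (factor-snoc (suc i) n)) ⟩
  binom (factor (suc i) (suc n)) [1]                    ∎))
  where
  open ≤-Reasoning
  head-step : (a : Letter) (w : Word) → binom (a ∷ w) [1] ≤ suc (binom w [1])
  head-step zero w = n≤1+n _
  head-step (suc zero) w = ≤-refl
  head-step (suc (suc zero)) w = n≤1+n _

abelianComplexity-unbounded : (M : ℕ) → ∃ λ n → ∃ λ k → BinomComplexity 1 n k × M < k
abelianComplexity-unbounded M =
  n , k , cc , classCount-≥ (∼-isEquivalence 1) cc witness λ a b a≢b r →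
    a≢b (Fin.toℕ-injective (trans (sym (witness-ones a)) (trans (r [1] (s≤s z≤n)) (witness-ones b))))
  where
  n : ℕ
  n = blockStart M
  k : ℕ
  k = proj₁ (binomComplexity-exists 1 n)
  cc : BinomComplexity 1 n k
  cc = proj₂ (binomComplexity-exists 1 n)
  ones : ℕ → ℕ
  ones i = binom (factor i n) [1]
  ones-start : ones 0 ≡ M
  ones-start = trans (cong (λ w → binom w [1]) (factor-prefix M)) (binom-prefix-[1] M)
  ones-far : ones (suc (blockStart n)) ≡ 0
  ones-far = trans (cong (λ w → binom w [1]) (∷-injectiveʳ (factor-block n))) (binom-twos-1∷ n [])
  hit : (a : Fin (suc M)) → ∃ λ p → ones p ≡ toℕ a
  hit a = discrete-intermediate-value ones (ones-step n) (suc (blockStart n)) 0 (toℕ a)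
    (subst (toℕ a ≤_) (sym ones-start) (Fin.toℕ≤pred[n] a)) (≤-trans (≤-reflexive ones-far) z≤n)
  witness : Fin (suc M) → ℕ
  witness a = proj₁ (hit a)
  witness-ones : (a : Fin (suc M)) → ones (witness a) ≡ toℕ a
  witness-ones a = proj₂ (hit a)

1-twos∼₁2-1-twos : (N : ℕ) → (one ∷ twos (suc N)) ∼[ 1 ] (two ∷ one ∷ twos N)
1-twos∼₁2-1-twos N = ∼₁-intro _ _
  (trans (binom-twos-0∷ (suc N) []) (sym (binom-twos-0∷ N [])))
  (cong suc (trans (binom-twos-1∷ (suc N) []) (sym (binom-twos-1∷ N []))))
  (trans (binom-twos-[2] (suc N)) (cong suc (sym (binom-twos-[2] N))))

1-twos≁₂2-1-twos : (N : ℕ) → ¬ (one ∷ twos (suc N)) ∼[ 2 ] (two ∷ one ∷ twos N)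
1-twos≁₂2-1-twos N r = 1+n≢n (begin
  suc N
    ≡⟨ sym (+-identityʳ (suc N)) ⟩
  suc N + 0
    ≡⟨ sym (cong₂ _+_ (binom-twos-[2] (suc N)) (binom-twos-1∷ (suc N) [2])) ⟩
  binom (twos (suc N)) [2] + binom (twos (suc N)) [12]
    ≡⟨ r [12] ≤-refl ⟩
  binom (twos N) [2] + binom (twos N) [12]
    ≡⟨ cong₂ _+_ (binom-twos-[2] N) (binom-twos-1∷ N [2]) ⟩
  N + 0
    ≡⟨ +-identityʳ N ⟩
  N ∎)
  where open ≡-Reasoning

abelianComplexity≺binomComplexity₂ : BinomComplexity 1 ≺ BinomComplexity 2
abelianComplexity≺binomComplexity₂ = binomComplexity-≺ λ N →
  let n : ℕ
      n = suc (suc N)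
      u-at : factor (blockStart n) n ≡ one ∷ twos (suc N)
      u-at = trans (factor-at-blockStart (n≤1+n n)) (window-spike 0 (suc N))
      v-at : factor (blockStart n + n) n ≡ two ∷ one ∷ twos N
      v-at = trans (factor-inside-block (s≤s z≤n) (+-identityʳ n) (≤-trans (n≤1+n n) (≤-trans (n≤1+n _) (n≤1+n _))))
                   (window-spike 1 N)
  in n , ≤-trans (n≤1+n N) (n≤1+n _) , blockStart n , blockStart n + n ,
     subst₂ (λ u v → u ∼[ 1 ] v) (sym u-at) (sym v-at) (1-twos∼₁2-1-twos N) ,
     λ r → 1-twos≁₂2-1-twos N (subst₂ (λ u v → u ∼[ 2 ] v) u-at v-at r)

1-twos-1 : ℕ → Word
1-twos-1 a = one ∷ twos a ++ one ∷ []

2-1-twos-1-2 : ℕ → Word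
2-1-twos-1-2 b = two ∷ one ∷ twos b ++ one ∷ two ∷ []

module _ (b : ℕ) where
  private
    a : ℕ
    a = suc (suc b)
    u v : Word
    u = 1-twos-1 a
    v = 2-1-twos-1-2 b

    u-[2] : binom u [2] ≡ a
    u-[2] = trans (binom-twos++-[2] a (one ∷ [])) (+-identityʳ a)

    v-[2] : binom v [2] ≡ a
    v-[2] = cong suc (trans (binom-twos++-[2] b (one ∷ two ∷ [])) (+-comm b 1))

    u-[12] : binom u [12] ≡ a
    u-[12] = trans (cong₂ _+_ u-[2] (binom-twos++-1∷ a (one ∷ []) [2])) (+-identityʳ a)

    v-[12] : binom v [12] ≡ a
    v-[12] = trans (cong₂ _+_ (binom-twos++-[2] b (one ∷ two ∷ [])) (binom-twos++-1∷ b (one ∷ two ∷ []) [2]))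
      (trans (+-suc (b + 1) 0) (cong suc (trans (+-identityʳ (b + 1)) (+-comm b 1))))

    u-[121] : binom u [121] ≡ a
    u-[121] = trans (cong₂ _+_ (binom-twos++-[21] a (one ∷ [])) (binom-twos++-1∷ a (one ∷ []) [21]))
      (trans (+-identityʳ _) (trans (+-identityʳ _) (*-identityʳ a)))

    v-[121] : binom v [121] ≡ b
    v-[121] = trans (cong₂ _+_ (binom-twos++-[21] b (one ∷ two ∷ [])) (binom-twos++-1∷ b (one ∷ two ∷ []) [21]))
      (trans (+-identityʳ _) (trans (+-identityʳ _) (*-identityʳ b)))

  1-twos-1∼₂2-1-twos-1-2 : 1-twos-1 (suc (suc b)) ∼[ 2 ] 2-1-twos-1-2 b
  1-twos-1∼₂2-1-twos-1-2 = ∼₂-intro u v (binom-twos++-0∷ a (one ∷ []) []) (binom-twos++-0∷ b (one ∷ two ∷ []) [])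
    (cong suc (trans (binom-twos++-1∷ a (one ∷ []) []) (sym (binom-twos++-1∷ b (one ∷ two ∷ []) []))))
    (trans u-[2] (sym v-[2])) (trans u-[12] (sym v-[12]))

  1-twos-1≁₃2-1-twos-1-2 : ¬ 1-twos-1 (suc (suc b)) ∼[ 3 ] 2-1-twos-1-2 b
  1-twos-1≁₃2-1-twos-1-2 r = m≢1+n+m b {1} (trans (sym v-[121]) (trans (sym (r [121] ≤-refl)) u-[121]))

shift-two-blocks : ∀ T N → suc (T + suc N) + suc N + suc (suc (suc (suc N))) ≡
  suc ((T + suc N + suc (suc N)) + suc (suc (suc N)))
shift-two-blocks = solve-∀

binomComplexity₂≺binomComplexity₃ : BinomComplexity 2 ≺ BinomComplexity 3
binomComplexity₂≺binomComplexity₃ = binomComplexity-≺ λ N →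
  let m : ℕ
      m = suc (suc (suc (suc N)))
      u-at : factor (blockStart m) (m + 2) ≡ 1-twos-1 m
      u-at = trans (cong (factor (blockStart m)) (+-suc m 1))
        (trans (factor-++ (blockStart m) (suc m) 1)
          (cong₂ _++_ (factor-block m) (factor-at-blockStart {J = suc m} (s≤s z≤n))))
      v-at : factor (blockStart (suc N) + suc N) (m + 2) ≡ 2-1-twos-1-2 (suc (suc N))
      v-at = trans (factor-++ (blockStart (suc N) + suc N) m 2) (cong₂ _++_
        (trans (factor-inside-block (s≤s z≤n) (+-identityʳ (suc N)) ≤-refl) (window-spike 1 (suc (suc N))))
        (trans (cong (λ p → factor p 2) (shift-two-blocks (triangle N) N))
               (factor-at-blockStart {J = suc (suc (suc N))} (s≤s (s≤s z≤n)))))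
  in m + 2 , ≤-trans (m≤n+m N 4) (m≤m+n m 2) , blockStart m , blockStart (suc N) + suc N ,
     subst₂ (λ u v → u ∼[ 2 ] v) (sym u-at) (sym v-at) (1-twos-1∼₂2-1-twos-1-2 (suc (suc N))) ,
     λ r → 1-twos-1≁₃2-1-twos-1-2 (suc (suc N)) (subst₂ (λ u v → u ∼[ 3 ] v) u-at v-at r)

theorem7p4 : ((M : ℕ) → ∃ λ n → ∃ λ k → BinomComplexity 1 n k × M < k)
    × (BinomComplexity 1 ≺ BinomComplexity 2)
    × (BinomComplexity 2 ≺ BinomComplexity 3)
    × ((n : ℕ) → ∃ λ k → BinomComplexity 3 n k × FactorComplexity n k)
theorem7p4 =
    abelianComplexity-unbounded
  , abelianComplexity≺binomComplexity₂
  , binomComplexity₂≺binomComplexity₃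
  , binomComplexity-3≡factorComplexity
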